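{- Let $n\ge 1$, and let $G_n$, $\widehat{G}_n$, $r_n$, $y_n$ and $t_n$ be as defined in the context. Let $F$ be a finite simple graph containing $\widehat{G}_n$ as an induced subgraph, such that there is no edge between $V(G_n)$ and $V(F)\setminus V(\widehat{G}_n)$; thus the only edge of $F$ joining $V(G_n)$ to the rest of $F$ is $r_ny_n$. Then for every zero forcing set $P$ of $F$: (i) $|V(G_n)\cap P|\ge t_n$; (ii) if $|V(G_n)\cap P|=t_n$, then $r_n\notin P$, and in the zero forcing process on $F$ started from $P$, the vertex $r_n$ is never forced by a vertex of $G_n$ (i.e. $r_n$ can only be forced by $y_n$).
   Context: Zero forcing: given a graph and a set $S$ of initially black vertices (all others white), repeatedly apply the rule: if a black vertex $v$ has exactly one white neighbor $u$, then $v$ forces $u$, and $u$ becomes black (and stays black). $S$ is a zero forcing set if every vertex eventually becomes black. $Z(G)$ is the minimum size of a zero forcing set of $G$. Construction: for $d\ge1$, let $B_d$ be the complete binary tree on $2^d-1$ vertices with root $r$ ($B_1$ is a single vertex; for $d>1$ the root has two children which are roots of copies of $B_{d-1}$). A subdivided $K_4$ is the graph obtained from $K_4$ on vertices $a,b,c,e$ by subdividing the edge $ab$ with a new vertex $\ell$. For $n\ge1$, $G_n$ is obtained from $B_{2n-1}$ by attaching to every leaf $\ell$ of $B_{2n-1}$ a private copy of the subdivided $K_4$ in which $\ell$ plays the role of the subdividing vertex (i.e. add new vertices $a,b,c,e$ with edges $\ell a,\ell b,ac,ae,bc,be,ce$). Let $r_n$ denote the root of $B_{2n-1}$ in $G_n$.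 The graph $\widehat{G}_n$ is obtained from $G_n$ by adding a new vertex $y_n$ adjacent only to $r_n$. Both graphs have maximum degree 3, and $|V(\widehat{G}_n)|=6\cdot 4^{n-1}$. The sequence $t_n$ is defined by $t_1=2$ and $t_{n+1}=4t_n+2$ for $n\ge1$. -}

module Defs where

open import Data.Nat using (ℕ; zero; suc; _+_; _*_; _∸_; _^_; _≤_; _<_)
open import Data.Fin using (Fin; toℕ)
open import Data.Fin.Subset using (Subset; _∈_; _∉_; _∪_; ⁅_⁆; ∣_∣)
open import Data.Vec using (tabulate; lookup)
open import Data.Bool using (Bool; true; false; _∧_)
open import Data.List using (List; []; _∷_)
import Data.List.Membership.Propositional as ListMem
open import Data.Product using (_×_; _,_; ∃; ∃-syntax; Σ)
open import Relation.Binary.PropositionalEquality using (_≡_; _≢_)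
open import Relation.Nullary using (¬_)
open import Data.Sum using (_⊎_)

record SimpleGraph (N : ℕ) : Set₁ where
  field
    Adj     : Fin N → Fin N → Set
    symm    : ∀ {x y} → Adj x y → Adj y x
    irrefl  : ∀ {x} → ¬ Adj x x
open SimpleGraph public

-- Zero forcing (Subset N = Vec Bool N; x ∈ B means x is black)

module _ {N : ℕ} (G : SimpleGraph N) where

  Forces : Subset N → Fin N → Fin N → Set
  Forces B v u =
    v ∈ B × u ∉ B × Adj G v u × (∀ w → Adj G v w → w ∉ B → w ≡ u)

  data ForceSeq : Subset N → List (Fin N × Fin N) → Subset N → Set where
    done : ∀ {B} → ForceSeq B [] B
    step : ∀ {B B' v u fs} → Forces B v u →
           ForceSeq (B ∪ ⁅ u ⁆) fs B' → ForceSeq B ((v , u) ∷ fs) B'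

  ZeroForcingSet : Subset N → Set
  ZeroForcingSet P = ∃[ fs ] ∃[ B' ] (ForceSeq P fs B' × (∀ x → x ∈ B'))

-- The graph Ĝ_n, with vertices encoded as natural numbers  0 .. 6·4^(n-1) - 1
--   (d = 2n-1, L = 2^(d-1) = 4^(n-1) leaves of B_d)
--   0                 : y_n
--   1 .. 2L-1         : vertices of B_{2n-1} in heap order (root r_n = 1,
--                       children of i are 2i and 2i+1); leaves are L .. 2L-1
--   2L + 4m + j       : for the leaf ℓ = L + m (m < L), the vertices a,b,c,e
--                       (j = 0,1,2,3) of its private subdivided K4.
-- V(G_n) consists of all codes except 0.

L : ℕ → ℕ
L n = 4 ^ (n ∸ 1)

size : ℕ → ℕ
size n = 6 * L n

gad : ℕ → ℕ → ℕ → ℕ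
gad n m j = 2 * L n + 4 * m + j

data Edge (n : ℕ) : ℕ → ℕ → Set where
  y-root : Edge n 0 1
  tree-l : ∀ i → 1 ≤ i → 2 * i < 2 * L n → Edge n i (2 * i)
  tree-r : ∀ i → 1 ≤ i → 2 * i + 1 < 2 * L n → Edge n i (2 * i + 1)
  leaf-a : ∀ m → m < L n → Edge n (L n + m) (gad n m 0)
  leaf-b : ∀ m → m < L n → Edge n (L n + m) (gad n m 1)
  a-c    : ∀ m → m < L n → Edge n (gad n m 0) (gad n m 2)
  a-e    : ∀ m → m < L n → Edge n (gad n m 0) (gad n m 3)
  b-c    : ∀ m → m < L n → Edge n (gad n m 1) (gad n m 2)
  b-e    : ∀ m → m < L n → Edge n (gad n m 1) (gad n m 3)
  c-e    : ∀ m → m < L n → Edge n (gad n m 2) (gad n m 3)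

AdjĜ : (n : ℕ) → Fin (size n) → Fin (size n) → Set
AdjĜ n x y = Edge n (toℕ x) (toℕ y) ⊎ Edge n (toℕ y) (toℕ x)

InG : {n : ℕ} → Fin (size n) → Set
InG x = toℕ x ≢ 0

isG : {n : ℕ} → Fin (size n) → Bool
isG x with toℕ x
... | zero  = false
... | suc _ = true

record GoodEmbedding (n : ℕ) {N : ℕ} (F : SimpleGraph N)
                     (φ : Fin (size n) → Fin N) : Set where
  field
    injective : ∀ x y → φ x ≡ φ y → x ≡ y
    induced   : ∀ x y → (AdjĜ n x y → Adj F (φ x) (φ y))
                      × (Adj F (φ x) (φ y) → AdjĜ n x y)
    isolated  : ∀ x w → InG {n} x → (∀ z → φ z ≢ w) → ¬ Adj F (φ x) w

countGP : (n : ℕ) {N : ℕ} → (Fin (size n) → Fin N) → Subset N → ℕ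
countGP n φ P = ∣ tabulate (λ x → isG {n} x ∧ lookup P (φ x)) ∣

-- the sequence t_n  (t 0 is an unused junk value)
t : ℕ → ℕ
t zero = 0
t (suc zero) = 2
t (suc (suc n)) = 4 * t (suc n) + 2

_∈ₗ_ : {A : Set} → A → List A → Set
_∈ₗ_ = ListMem._∈_

-- A set W of vertices is a fort if every vertex outside W with a neighbour in W has at
-- least two neighbours in W; a forcing process that starts with W entirely white never
-- forces a vertex of W.  In each subdivided K₄ the sets {c,e}, {a,b,e} and {a,b,c} are forts,
-- so a zero forcing set contains two of a, b, c, e; if it contains exactly two and not ℓ,
-- then ℓ and the two white ones form a fort except at the parent of ℓ, so only that parent
-- can force ℓ.  By induction on j, the subtree of height 2j below a vertex c, together with
-- its gadgets, contains at least t (j+1) vertices of P, and if exactly that many then c is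
-- white and can only be forced by its parent.  For height 2j+2, two tight grandchildren with
-- the same parent would both have to be forced by that parent, which forces only once, so
-- each pair of grandchildren contributes at least 2t+1 and the total is at least
-- 4t+2 = t (j+2); in the tight case each child of c must force its own tight child, so it
-- cannot force c.  At the root r_n (height 2n−2) this is the theorem, as y_n is the only
-- other neighbour of r_n.

module Submission where

open import Defs
open import Level using (0ℓ)
open import Function using (_∘_)
open import Data.Nat
open import Data.Nat.Properties
open import Data.Nat.Tactic.RingSolver using (solve-∀)
open import Algebra.Properties.CommutativeSemigroup +-commutativeSemigroup using (interchange)
open import Data.Bool using (Bool; true; false; _∧_)
open import Data.Fin using (Fin; zero; suc; toℕ; fromℕ<)
import Data.Fin as Fin
open import Data.Fin.Properties using (all?; any?; toℕ<n; toℕ-injective; toℕ-fromℕ<)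
open import Data.Fin.Subset using (Subset; _∈_; _∉_; _∪_; ⁅_⁆; _⊆_; ∣_∣)
open import Data.Fin.Subset.Properties using (p⊆p∪q; x∈p∪q⁻; x∈p∪q⁺; x∈⁅y⁆⇒x≡y; x∈⁅x⁆; _∈?_)
open import Data.Vec using (lookup; tabulate; _∷_)
open import Data.Vec.Properties using ([]=⇒lookup)
open import Data.List using (List; []; _∷_; _++_)
open import Data.List.Relation.Unary.Any using (here; there)
open import Data.List.Membership.Propositional.Properties using (∈-++⁺ˡ)
import Data.List.Membership.DecPropositional as DecMembership
open import Data.Product using (_×_; _,_; ∃-syntax; Σ-syntax; proj₁; proj₂)
open import Data.Product.Properties using (≡-dec)
open import Data.Sum using (_⊎_; inj₁; inj₂)
open import Data.Empty using (⊥; ⊥-elim)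
open import Relation.Nullary using (¬_; Dec; yes; no)
open import Relation.Nullary.Decidable using (True; toWitness; ¬?; _×-dec_; _→-dec_; _⊎-dec_; from-yes)
open import Relation.Unary using (Pred; Decidable)
open import Relation.Binary using (tri<; tri≈; tri>)
open import Relation.Binary.PropositionalEquality

open DecMembership (≡-dec (Fin._≟_ {6}) (Fin._≟_ {6})) using () renaming (_∈?_ to _∈ᴱ?_)
open DecMembership (Fin._≟_ {6}) using () renaming (_∈?_ to _∈ₗ?_)

-- Zero forcing and forts

module ZeroForcing {N : ℕ} (F : SimpleGraph N) where

  ForceSeq-⊆ : ∀ {B fs B'} → ForceSeq F B fs B' → B ⊆ B'
  ForceSeq-⊆ done             = λ x∈B → x∈B
  ForceSeq-⊆ (step {u = u} _ s) = λ x∈B → ForceSeq-⊆ s (p⊆p∪q ⁅ u ⁆ x∈B)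

  force-occurs : ∀ {B fs B' v u} → ForceSeq F B fs B' → (v , u) ∈ₗ fs →
                 Σ[ D ∈ Subset N ] (B ⊆ D × Forces F D v u)
  force-occurs (step f s) (here refl) = _ , (λ x∈B → x∈B) , f
  force-occurs (step {u = u} f s) (there m) with force-occurs s m
  ... | D , B'⊆D , g = D , (λ x∈B → B'⊆D (p⊆p∪q ⁅ u ⁆ x∈B)) , g

  forced-adjacent : ∀ {B fs B' v u} → ForceSeq F B fs B' → (v , u) ∈ₗ fs → Adj F v u
  forced-adjacent s m with force-occurs s m
  ... | _ , _ , (_ , _ , v~u , _) = v~u

  black-never-forced : ∀ {B fs B' v u} → ForceSeq F B fs B' → u ∈ B → ¬ (v , u) ∈ₗ fs
  black-never-forced s u∈B m with force-occurs s m
  ... | _ , B⊆D , (_ , u∉D , _ , _) = u∉D (B⊆D u∈B)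

  turned-black-was-forced : ∀ {B fs B' u} → ForceSeq F B fs B' → u ∈ B' → u ∉ B →
                            ∃[ v ] (v , u) ∈ₗ fs
  turned-black-was-forced done u∈B' u∉B = ⊥-elim (u∉B u∈B')
  turned-black-was-forced {u = u} (step {B = B} {v = v} {u = u₀} _ s) u∈B' u∉B with u Fin.≟ u₀
  ... | yes refl = v , here refl
  ... | no u≢u₀ with turned-black-was-forced s u∈B' u∉B∪u₀
    where
    u∉B∪u₀ : u ∉ B ∪ ⁅ u₀ ⁆
    u∉B∪u₀ u∈ with x∈p∪q⁻ B ⁅ u₀ ⁆ u∈
    ... | inj₁ u∈B  = u∉B u∈B
    ... | inj₂ u∈u₀ = u≢u₀ (x∈⁅y⁆⇒x≡y u₀ u∈u₀)
  ... | w , m = w , there m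

  forces-at-most-once : ∀ {B fs B' v u₁ u₂} → ForceSeq F B fs B' →
                        (v , u₁) ∈ₗ fs → (v , u₂) ∈ₗ fs → u₁ ≡ u₂
  forces-at-most-once (step f s) (here refl) (here refl) = refl
  forces-at-most-once (step f s) (here refl) (there m)   = forced-is-last-white f s m
    where
    forced-is-last-white : ∀ {B v u₀ fs B' u₂} → Forces F B v u₀ →
                           ForceSeq F (B ∪ ⁅ u₀ ⁆) fs B' → (v , u₂) ∈ₗ fs → u₀ ≡ u₂
    forced-is-last-white {u₀ = u₀} (_ , _ , _ , only-white) s m with force-occurs s m
    ... | _ , B⊆D , (_ , u₂∉D , v~u₂ , _) =
      sym (only-white _ v~u₂ (λ u₂∈B → u₂∉D (B⊆D (p⊆p∪q ⁅ u₀ ⁆ u₂∈B))))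
  forces-at-most-once (step f s) (there m) (here refl) =
    sym (forces-at-most-once (step f s) (here refl) (there m))
  forces-at-most-once (step f s) (there m) (there m') = forces-at-most-once s m m'

  module Fort (W : Pred (Fin N) 0ℓ) (W? : Decidable W) where

    AllWhite : Subset N → Set
    AllWhite B = ∀ x → W x → x ∉ B

    TwoNeighboursIn : Fin N → Fin N → Set
    TwoNeighboursIn v u = ∃[ u' ] (W u' × u' ≢ u × Adj F v u')

    IsFort : Set
    IsFort = ∀ v u → ¬ W v → W u → Adj F v u → TwoNeighboursIn v u

    IsFortExcept : Fin N → Set
    IsFortExcept p = ∀ v u → ¬ W v → W u → Adj F v u → v ≡ p ⊎ TwoNeighboursIn v u

    private
      AllWhite-∪ : ∀ {B u} → AllWhite B → ¬ W u → AllWhite (B ∪ ⁅ u ⁆)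
      AllWhite-∪ {B} {u} white u∉W x x∈W x∈B∪u with x∈p∪q⁻ B ⁅ u ⁆ x∈B∪u
      ... | inj₁ x∈B  = white x x∈W x∈B
      ... | inj₂ x∈u = u∉W (subst W (x∈⁅y⁆⇒x≡y u x∈u) x∈W)

      forces-outside : ∀ {B v u} → AllWhite B → Forces F B v u → W u → ¬ TwoNeighboursIn v u
      forces-outside white (_ , _ , _ , only-white) u∈W (u' , u'∈W , u'≢u , v~u') =
        u'≢u (only-white u' v~u' (white u' u'∈W))

    fort-stays-white : ∀ {B fs B'} → IsFort → AllWhite B → ForceSeq F B fs B' → AllWhite B'
    fort-stays-white fort white done = white
    fort-stays-white fort white (step {u = u} f@(v∈B , _ , v~u , _) s) with W? u
    ... | no u∉W  = fort-stays-white fort (AllWhite-∪ white u∉W) s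
    ... | yes u∈W = ⊥-elim (forces-outside white f u∈W
                              (fort _ u (λ v∈W → white _ v∈W v∈B) u∈W v~u))

    fort-except-forced-by : ∀ {B fs B' p l v} → IsFortExcept p →
                            (∀ u → W u → Adj F p u → u ≡ l) → W l → AllWhite B →
                            ForceSeq F B fs B' → (v , l) ∈ₗ fs → v ≡ p
    fort-except-forced-by fort gate l∈W white (step {u = u} f s) m with W? u
    fort-except-forced-by fort gate l∈W white (step f s) (here refl)  | no u∉W = ⊥-elim (u∉W l∈W)
    fort-except-forced-by fort gate l∈W white (step f s) (there m)    | no u∉W =
      fort-except-forced-by fort gate l∈W (AllWhite-∪ white u∉W) s m
    fort-except-forced-by fort gate l∈W white (step {v = w} {u = u} f@(w∈B , _ , w~u , _) s) m | yes u∈W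
      with fort w u (λ w∈W → white w w∈W w∈B) u∈W w~u
    ... | inj₂ two = ⊥-elim (forces-outside white f u∈W two)
    ... | inj₁ refl with gate u u∈W w~u | m
    ...   | refl | here refl = refl
    ...   | refl | there m'  = ⊥-elim (black-never-forced s (x∈p∪q⁺ (inj₂ (x∈⁅x⁆ u))) m')

  private
    replay : ∀ {B fs B₀ C} → ForceSeq F B fs B₀ → B ⊆ C →
             Σ[ fs' ∈ List (Fin N × Fin N) ] Σ[ C' ∈ Subset N ] (ForceSeq F C fs' C' × B₀ ⊆ C')
    replay {C = C} done B⊆C = [] , C , done , B⊆C
    replay {B = B} {C = C} (step {v = v} {u = u} (v∈B , _ , v~u , only-white) s) B⊆C with u ∈? C
    ... | yes u∈C = replay s B∪u⊆C
      where
      B∪u⊆C : B ∪ ⁅ u ⁆ ⊆ C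
      B∪u⊆C x∈ with x∈p∪q⁻ B ⁅ u ⁆ x∈
      ... | inj₁ x∈B = B⊆C x∈B
      ... | inj₂ x∈u = subst (_∈ C) (sym (x∈⁅y⁆⇒x≡y u x∈u)) u∈C
    ... | no u∉C with replay s B∪u⊆C∪u
      where
      B∪u⊆C∪u : B ∪ ⁅ u ⁆ ⊆ C ∪ ⁅ u ⁆
      B∪u⊆C∪u x∈ with x∈p∪q⁻ B ⁅ u ⁆ x∈
      ... | inj₁ x∈B = x∈p∪q⁺ (inj₁ (B⊆C x∈B))
      ... | inj₂ x∈u = x∈p∪q⁺ (inj₂ x∈u)
    ... | fs' , C' , s' , B₀⊆C' =
      (v , u) ∷ fs' , C' ,
      step (B⊆C v∈B , u∉C , v~u , λ w v~w w∉C → only-white w v~w (λ w∈B → w∉C (B⊆C w∈B))) s' ,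
      B₀⊆C'

    ForceSeq-++ : ∀ {B fs B₁ fs' B₂} → ForceSeq F B fs B₁ → ForceSeq F B₁ fs' B₂ →
                  ForceSeq F B (fs ++ fs') B₂
    ForceSeq-++ done s' = s'
    ForceSeq-++ (step f s) s' = step f (ForceSeq-++ s s')

  extend-to-complete : ∀ {P fs B'} → ZeroForcingSet F P → ForceSeq F P fs B' →
                       Σ[ fs₂ ∈ List (Fin N × Fin N) ] Σ[ B₂ ∈ Subset N ]
                       (ForceSeq F P fs₂ B₂ × (∀ x → x ∈ B₂) × (∀ {f} → f ∈ₗ fs → f ∈ₗ fs₂))
  extend-to-complete {fs = fs} (fs₀ , B₀ , s₀ , all-black) s with replay s₀ (ForceSeq-⊆ s)
  ... | fs' , C' , s' , B₀⊆C' =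
    fs ++ fs' , C' , ForceSeq-++ s s' , (λ x → B₀⊆C' (all-black x)) , ∈-++⁺ˡ

-- The subdivided K₄ gadget

χ : Bool → ℕ
χ true  = 1
χ false = 0

χ≡0⇒false : ∀ {b} → χ b ≡ 0 → b ≡ false
χ≡0⇒false {false} _ = refl

lookup≡false⇒∉ : ∀ {N} (P : Subset N) x → lookup P x ≡ false → x ∉ P
lookup≡false⇒∉ P x eq x∈P with trans (sym ([]=⇒lookup x∈P)) eq
... | ()

-- Fin 6 numbers the gadget at a leaf ℓ: the parent p of ℓ, then ℓ, a, b, c, e.
pattern parent = zero
pattern leaf   = suc zero
pattern ga     = suc (suc zero)
pattern gb     = suc (suc (suc zero))
pattern gc     = suc (suc (suc (suc zero)))
pattern ge     = suc (suc (suc (suc (suc zero))))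

gadget-edges : List (Fin 6 × Fin 6)
gadget-edges = (parent , leaf) ∷ (leaf , ga) ∷ (leaf , gb) ∷
               (ga , gc) ∷ (ga , ge) ∷ (gb , gc) ∷ (gb , ge) ∷ (gc , ge) ∷ []

GadgetAdj : Fin 6 → Fin 6 → Set
GadgetAdj x y = (x , y) ∈ₗ gadget-edges ⊎ (y , x) ∈ₗ gadget-edges

GadgetAdj? : ∀ x y → Dec (GadgetAdj x y)
GadgetAdj? x y = ((x , y) ∈ᴱ? gadget-edges) ⊎-dec ((y , x) ∈ᴱ? gadget-edges)

TwoLocalNeighboursIn : List (Fin 6) → Fin 6 → Fin 6 → Set
TwoLocalNeighboursIn W y u = ∃[ u' ] (u' ∈ₗ W × u' ≢ u × GadgetAdj y u')

IsLocalFort IsLocalFortExceptParent : List (Fin 6) → Set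
IsLocalFort W = ¬ parent ∈ₗ W ×
  (∀ u → u ∈ₗ W → ∀ y → GadgetAdj u y → ¬ y ∈ₗ W → TwoLocalNeighboursIn W y u)
IsLocalFortExceptParent W = ¬ parent ∈ₗ W ×
  (∀ u → u ∈ₗ W → ∀ y → GadgetAdj u y → ¬ y ∈ₗ W → y ≡ parent ⊎ TwoLocalNeighboursIn W y u)

private
  TwoLocalNeighboursIn? : ∀ W y u → Dec (TwoLocalNeighboursIn W y u)
  TwoLocalNeighboursIn? W y u = any? λ u' → (u' ∈ₗ? W) ×-dec ¬? (u' Fin.≟ u) ×-dec GadgetAdj? y u'

IsLocalFort? : ∀ W → Dec (IsLocalFort W)
IsLocalFort? W = ¬? (parent ∈ₗ? W) ×-dec
  all? λ u → (u ∈ₗ? W) →-dec all? λ y → GadgetAdj? u y →-dec ¬? (y ∈ₗ? W) →-dec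
    TwoLocalNeighboursIn? W y u

IsLocalFortExceptParent? : ∀ W → Dec (IsLocalFortExceptParent W)
IsLocalFortExceptParent? W = ¬? (parent ∈ₗ? W) ×-dec
  all? λ u → (u ∈ₗ? W) →-dec all? λ y → GadgetAdj? u y →-dec ¬? (y ∈ₗ? W) →-dec
    (y Fin.≟ parent ⊎-dec TwoLocalNeighboursIn? W y u)

adjacent-to-parent : ∀ u → GadgetAdj u parent → u ≡ leaf
adjacent-to-parent = from-yes (all? λ u → GadgetAdj? u parent →-dec u Fin.≟ leaf)

record GadgetEmbedding {N : ℕ} (F : SimpleGraph N) (ι : Fin 6 → Fin N) : Set where
  field
    injective : ∀ x y → ι x ≡ ι y → x ≡ y
    sound     : ∀ {x y} → GadgetAdj x y → Adj F (ι x) (ι y)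
    closed    : ∀ {x w} → x ≢ parent → Adj F (ι x) w → ∃[ y ] (w ≡ ι y × GadgetAdj x y)

module GadgetForcing {N : ℕ} {F : SimpleGraph N} {ι : Fin 6 → Fin N} (emb : GadgetEmbedding F ι)
         {P : Subset N} {fs : List (Fin N × Fin N)} {B' : Subset N}
         (seq : ForceSeq F P fs B') (all-black : ∀ x → x ∈ B') where

  open GadgetEmbedding emb
  open ZeroForcing F

  AllWhiteIn : List (Fin 6) → Set
  AllWhiteIn W = ∀ j → j ∈ₗ W → ι j ∉ P

  private
    module Image (W : List (Fin 6)) (parent∉W : ¬ parent ∈ₗ W) where
      Img : Fin N → Set
      Img x = ∃[ i ] (i ∈ₗ W × x ≡ ι i)

      open Fort Img (λ x → any? λ i → (i ∈ₗ? W) ×-dec (x Fin.≟ ι i)) public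

      ≢parent : ∀ {i} → i ∈ₗ W → i ≢ parent
      ≢parent i∈W refl = parent∉W i∈W

      outside : ∀ {y} → ¬ Img (ι y) → ¬ y ∈ₗ W
      outside ∉Img y∈W = ∉Img (_ , y∈W , refl)

      lift-two : ∀ {y u} → TwoLocalNeighboursIn W y u → TwoNeighboursIn (ι y) (ι u)
      lift-two (u' , u'∈W , u'≢u , y~u') =
        ι u' , (u' , u'∈W , refl) , (λ eq → u'≢u (injective _ _ eq)) , sound y~u'

      fort : IsLocalFort W → IsFort
      fort (_ , two) v u v∉ (i , i∈W , refl) v~u with closed (≢parent i∈W) (symm F v~u)
      ... | y , refl , i~y = lift-two (two i i∈W y i~y (outside v∉))

      fort-except : IsLocalFortExceptParent W → IsFortExcept (ι parent)
      fort-except (_ , two) v u v∉ (i , i∈W , refl) v~u with closed (≢parent i∈W) (symm F v~u)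
      ... | y , refl , i~y with two i i∈W y i~y (outside v∉)
      ...   | inj₁ refl = inj₁ refl
      ...   | inj₂ t    = inj₂ (lift-two t)

      only-leaf-next-to-parent : ∀ u → Img u → Adj F (ι parent) u → u ≡ ι leaf
      only-leaf-next-to-parent u (i , i∈W , refl) p~u with closed (≢parent i∈W) (symm F p~u)
      ... | y , eq , i~y with injective _ _ eq
      ...   | refl = cong ι (adjacent-to-parent i i~y)

      image-white : AllWhiteIn W → AllWhite P
      image-white h x (i , i∈W , refl) = h i i∈W

  fort-contains-black : ∀ {W i} → IsLocalFort W → i ∈ₗ W → ¬ AllWhiteIn W
  fort-contains-black {W} {i} isFort@(parent∉W , _) i∈W h =
    fort-stays-white (fort isFort) (image-white h) seq (ι i) (i , i∈W , refl) (all-black (ι i))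
    where open Image W parent∉W

  leaf-forced-by-parent : ∀ {W v} → IsLocalFortExceptParent W → leaf ∈ₗ W →
                          AllWhiteIn W → (v , ι leaf) ∈ₗ fs → v ≡ ι parent
  leaf-forced-by-parent {W} isFort@(parent∉W , _) leaf∈W h =
    fort-except-forced-by (fort-except isFort) only-leaf-next-to-parent (leaf , leaf∈W , refl) (image-white h) seq
    where open Image W parent∉W

  private
    black : Fin 6 → Bool
    black i = lookup P (ι i)

    white : ∀ {i} → black i ≡ false → ι i ∉ P
    white {i} = lookup≡false⇒∉ P (ι i)

    white-pair : ∀ {i j} → black i ≡ false → black j ≡ false → AllWhiteIn (i ∷ j ∷ [])
    white-pair wi wj _ (here refl)         = white wi
    white-pair wi wj _ (there (here refl)) = white wj

    white-triple : ∀ {i j k} → black i ≡ false → black j ≡ false → black k ≡ false →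
                   AllWhiteIn (i ∷ j ∷ k ∷ [])
    white-triple wi wj wk _ (here refl) = white wi
    white-triple wi wj wk _ (there m)   = white-pair wj wk _ m

    c-or-e : black gc ≡ false → black ge ≡ false → ⊥
    c-or-e wc we = fort-contains-black (from-yes (IsLocalFort? (gc ∷ ge ∷ []))) (here refl) (white-pair wc we)

    a-b-or-e : black ga ≡ false → black gb ≡ false → black ge ≡ false → ⊥
    a-b-or-e wa wb we =
      fort-contains-black (from-yes (IsLocalFort? (ga ∷ gb ∷ ge ∷ []))) (here refl) (white-triple wa wb we)

    a-b-or-c : black ga ≡ false → black gb ≡ false → black gc ≡ false → ⊥
    a-b-or-c wa wb wc =
      fort-contains-black (from-yes (IsLocalFort? (ga ∷ gb ∷ gc ∷ []))) (here refl) (white-triple wa wb wc)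

    two-of-four : ∀ {xa xb xc xe} → black ga ≡ xa → black gb ≡ xb → black gc ≡ xc → black ge ≡ xe →
                  2 ≤ χ xa + (χ xb + (χ xc + χ xe))
    two-of-four {true}  {true}           ea eb ec ee = s≤s (s≤s z≤n)
    two-of-four {true}  {false} {true}   ea eb ec ee = s≤s (s≤s z≤n)
    two-of-four {true}  {false} {false} {true}  ea eb ec ee = s≤s (s≤s z≤n)
    two-of-four {true}  {false} {false} {false} ea eb ec ee = ⊥-elim (c-or-e ec ee)
    two-of-four {false} {true}  {true}   ea eb ec ee = s≤s (s≤s z≤n)
    two-of-four {false} {true}  {false} {true}  ea eb ec ee = s≤s (s≤s z≤n)
    two-of-four {false} {true}  {false} {false} ea eb ec ee = ⊥-elim (c-or-e ec ee)
    two-of-four {false} {false} {true}  {true}  ea eb ec ee = s≤s (s≤s z≤n)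
    two-of-four {false} {false} {true}  {false} ea eb ec ee = ⊥-elim (a-b-or-e ea eb ee)
    two-of-four {false} {false} {false}         ea eb ec ee = ⊥-elim (a-b-or-c ea eb ec)

    -- with exactly two of a, b, c, e black, ℓ and the two white ones form a fort except at p
    leaf-white-fort : ∀ {j k} → True (IsLocalFortExceptParent? (leaf ∷ j ∷ k ∷ [])) →
                      black leaf ≡ false → black j ≡ false → black k ≡ false →
                      ∀ v → (v , ι leaf) ∈ₗ fs → v ≡ ι parent
    leaf-white-fort isFort wℓ wj wk v =
      leaf-forced-by-parent (toWitness isFort) (here refl) (white-triple wℓ wj wk)

    tight-four : ∀ {xa xb xc xe} → black ga ≡ xa → black gb ≡ xb → black gc ≡ xc → black ge ≡ xe →
                 black leaf ≡ false → χ xa + (χ xb + (χ xc + χ xe)) ≡ 2 →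
                 ∀ v → (v , ι leaf) ∈ₗ fs → v ≡ ι parent
    tight-four {true}  {true}  {true}  {_}     ea eb ec ee wℓ ()
    tight-four {true}  {true}  {false} {true}  ea eb ec ee wℓ ()
    tight-four {true}  {true}  {false} {false} ea eb ec ee wℓ _ = ⊥-elim (c-or-e ec ee)
    tight-four {true}  {false} {true}  {true}  ea eb ec ee wℓ ()
    tight-four {true}  {false} {true}  {false} ea eb ec ee wℓ _ = leaf-white-fort _ wℓ eb ee
    tight-four {true}  {false} {false} {true}  ea eb ec ee wℓ _ = leaf-white-fort _ wℓ eb ec
    tight-four {true}  {false} {false} {false} ea eb ec ee wℓ ()
    tight-four {false} {true}  {true}  {true}  ea eb ec ee wℓ ()
    tight-four {false} {true}  {true}  {false} ea eb ec ee wℓ _ = leaf-white-fort _ wℓ ea ee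
    tight-four {false} {true}  {false} {true}  ea eb ec ee wℓ _ = leaf-white-fort _ wℓ ea ec
    tight-four {false} {true}  {false} {false} ea eb ec ee wℓ ()
    tight-four {false} {false} {true}  {true}  ea eb ec ee wℓ _ = leaf-white-fort _ wℓ ea eb
    tight-four {false} {false} {true}  {false} ea eb ec ee wℓ ()
    tight-four {false} {false} {false} {true}  ea eb ec ee wℓ ()
    tight-four {false} {false} {false} {false} ea eb ec ee wℓ ()

  K4-weight : ℕ
  K4-weight = χ (black ga) + (χ (black gb) + (χ (black gc) + χ (black ge)))

  two-black-in-K4 : 2 ≤ K4-weight
  two-black-in-K4 = two-of-four refl refl refl refl

  gadget-tight : χ (black leaf) + K4-weight ≡ 2 →
                 ι leaf ∉ P × (∀ v → (v , ι leaf) ∈ₗ fs → v ≡ ι parent)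
  gadget-tight tight with black leaf in wℓ
  ... | true  = ⊥-elim (≤⇒≯ two-black-in-K4 (≤-reflexive tight))
  ... | false = white wℓ , tight-four refl refl refl refl wℓ tight

*+-mono-< : ∀ k {m m' j j'} → j < k → m < m' → k * m + j < k * m' + j'
*+-mono-< k {m} {m'} {j} {j'} j<k m<m' = begin-strict
  k * m + j   <⟨ +-monoʳ-< (k * m) j<k ⟩
  k * m + k   ≡⟨ +-comm (k * m) k ⟩
  k + k * m   ≡⟨ *-suc k m ⟨
  k * suc m   ≤⟨ *-monoʳ-≤ k m<m' ⟩
  k * m'      ≤⟨ m≤m+n (k * m') j' ⟩
  k * m' + j' ∎
  where open ≤-Reasoning

*+-injective : ∀ k {m m' j j'} → j < k → j' < k → k * m + j ≡ k * m' + j' → m ≡ m' × j ≡ j'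
*+-injective k {m} {m'} {j} {j'} j<k j'<k eq with <-cmp m m'
... | tri< m<m' _ _ = ⊥-elim (<⇒≢ (*+-mono-< k j<k m<m') eq)
... | tri≈ _ refl _ = refl , +-cancelˡ-≡ (k * m) j j' eq
... | tri> _ _ m'<m = ⊥-elim (<⇒≢ (*+-mono-< k j'<k m'<m) (sym eq))

pair-bound : ∀ {T x y} → T ≤ x → T ≤ y → ¬ (x ≡ T × y ≡ T) → suc (T + T) ≤ x + y
pair-bound {T} {x} {y} T≤x T≤y not-both with x ≟ T
... | no x≢T = +-mono-≤ (≤∧≢⇒< T≤x (≢-sym x≢T)) T≤y
... | yes refl = subst (_≤ x + y) (+-suc x x)
                   (+-monoʳ-≤ x (≤∧≢⇒< T≤y (λ T≡y → not-both (refl , sym T≡y))))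

pair-tight : ∀ {T x y} → T ≤ x → T ≤ y → x + y ≡ suc (T + T) → x ≡ T ⊎ y ≡ T
pair-tight {T} {x} {y} T≤x T≤y eq with x ≟ T | y ≟ T
... | yes x≡T | _        = inj₁ x≡T
... | no _    | yes y≡T  = inj₂ y≡T
... | no x≢T  | no y≢T   = ⊥-elim (<-irrefl refl (begin-strict
  suc (T + T)     <⟨ s≤s (+-monoʳ-< T (n<1+n T)) ⟩
  suc (T + suc T) ≡⟨⟩
  suc T + suc T   ≤⟨ +-mono-≤ (≤∧≢⇒< T≤x (≢-sym x≢T)) (≤∧≢⇒< T≤y (≢-sym y≢T)) ⟩
  x + y           ≡⟨ eq ⟩
  suc (T + T)     ∎))
  where open ≤-Reasoning

+-tight : ∀ {a a' c c'} → a ≤ a' → c ≤ c' → a' + c' ≡ a + c → a' ≡ a × c' ≡ c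
+-tight {a} {a'} {c} {c'} a≤a' c≤c' eq with m≤n⇒∃[o]m+o≡n a≤a' | m≤n⇒∃[o]m+o≡n c≤c'
... | δ , refl | ε , refl with m+n≡0⇒m≡0 δ δ+ε≡0 | m+n≡0⇒n≡0 δ δ+ε≡0
  where
  δ+ε≡0 : δ + ε ≡ 0
  δ+ε≡0 = +-cancelˡ-≡ (a + c) (δ + ε) 0 (trans (lem a c δ ε) (trans eq (sym (+-identityʳ (a + c)))))
    where lem : ∀ a c δ ε → a + c + (δ + ε) ≡ a + δ + (c + ε)
          lem = solve-∀
... | refl | refl = +-identityʳ a , +-identityʳ c

4T+2≡[2T+1]+[2T+1] : ∀ T → 4 * T + 2 ≡ suc (T + T) + suc (T + T)
4T+2≡[2T+1]+[2T+1] = solve-∀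

four-bound : ∀ {T b b₁ b₂ X Y} → suc (T + T) ≤ X → suc (T + T) ≤ Y →
             4 * T + 2 ≤ b + ((b₁ + X) + (b₂ + Y))
four-bound {T} {b} {b₁} {b₂} {X} {Y} m≤X m≤Y = begin
  4 * T + 2                         ≡⟨ 4T+2≡[2T+1]+[2T+1] T ⟩
  suc (T + T) + suc (T + T)         ≤⟨ +-mono-≤ (m≤n⇒m≤o+n b₁ m≤X) (m≤n⇒m≤o+n b₂ m≤Y) ⟩
  (b₁ + X) + (b₂ + Y)               ≤⟨ m≤n+m _ b ⟩
  b + ((b₁ + X) + (b₂ + Y))         ∎
  where open ≤-Reasoning

four-tight : ∀ {T b b₁ b₂ X Y} → suc (T + T) ≤ X → suc (T + T) ≤ Y →
             b + ((b₁ + X) + (b₂ + Y)) ≡ 4 * T + 2 →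
             b ≡ 0 × X ≡ suc (T + T) × Y ≡ suc (T + T)
four-tight {T} {b} {b₁} {b₂} {X} {Y} m≤X m≤Y eq
  with +-tight z≤n (+-mono-≤ (m≤n⇒m≤o+n b₁ m≤X) (m≤n⇒m≤o+n b₂ m≤Y)) (trans eq (4T+2≡[2T+1]+[2T+1] T))
... | b≡0 , sum≡ with +-tight (m≤n⇒m≤o+n b₁ m≤X) (m≤n⇒m≤o+n b₂ m≤Y) sum≡
... | b₁+X≡m , b₂+Y≡m = b≡0 , proj₂ (+-tight z≤n m≤X b₁+X≡m) , proj₂ (+-tight z≤n m≤Y b₂+Y≡m)

rangeSum : ℕ → ℕ → (ℕ → ℕ) → ℕ
rangeSum a zero    f = 0
rangeSum a (suc k) f = f a + rangeSum (suc a) k f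

rangeSum-++ : ∀ a k l f → rangeSum a (k + l) f ≡ rangeSum a k f + rangeSum (a + k) l f
rangeSum-++ a zero    l f = cong (λ b → rangeSum b l f) (sym (+-identityʳ a))
rangeSum-++ a (suc k) l f = begin
  f a + rangeSum (suc a) (k + l) f
    ≡⟨ cong (f a +_) (rangeSum-++ (suc a) k l f) ⟩
  f a + (rangeSum (suc a) k f + rangeSum (suc a + k) l f)
    ≡⟨ +-assoc (f a) _ _ ⟨
  f a + rangeSum (suc a) k f + rangeSum (suc a + k) l f
    ≡⟨ cong (λ b → f a + rangeSum (suc a) k f + rangeSum b l f) (+-suc a k) ⟨
  f a + rangeSum (suc a) k f + rangeSum (a + suc k) l f ∎
  where open ≡-Reasoning

rangeSum-cong : ∀ a k {f g} → (∀ i → a ≤ i → f i ≡ g i) → rangeSum a k f ≡ rangeSum a k g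
rangeSum-cong a zero    f≗g = refl
rangeSum-cong a (suc k) f≗g =
  cong₂ _+_ (f≗g a ≤-refl) (rangeSum-cong (suc a) k (λ i a<i → f≗g i (<⇒≤ a<i)))

rangeSum-+ : ∀ a k f g → rangeSum a k (λ i → f i + g i) ≡ rangeSum a k f + rangeSum a k g
rangeSum-+ a zero    f g = refl
rangeSum-+ a (suc k) f g = begin
  f a + g a + rangeSum (suc a) k (λ i → f i + g i)
    ≡⟨ cong (f a + g a +_) (rangeSum-+ (suc a) k f g) ⟩
  f a + g a + (rangeSum (suc a) k f + rangeSum (suc a) k g)
    ≡⟨ interchange (f a) (g a) _ _ ⟩
  f a + rangeSum (suc a) k f + (g a + rangeSum (suc a) k g) ∎
  where open ≡-Reasoning

rangeSum-shift : ∀ a b k f → rangeSum (a + b) k f ≡ rangeSum b k (λ i → f (a + i))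
rangeSum-shift a b zero    f = refl
rangeSum-shift a b (suc k) f =
  cong (f (a + b) +_) (trans (cong (λ c → rangeSum c k f) (sym (+-suc a b))) (rangeSum-shift a (suc b) k f))

rangeSum-pairs : ∀ c k f → rangeSum c k (λ i → f (2 * i) + f (2 * i + 1)) ≡ rangeSum (2 * c) (2 * k) f
rangeSum-pairs c zero    f = refl
rangeSum-pairs c (suc k) f = begin
  f (2 * c) + f (2 * c + 1) + rangeSum (suc c) k _
    ≡⟨ cong₂ (λ x y → f (2 * c) + f x + y) (+-comm (2 * c) 1) (rangeSum-pairs (suc c) k f) ⟩
  f (2 * c) + f (suc (2 * c)) + rangeSum (2 * suc c) (2 * k) f
    ≡⟨ +-assoc (f (2 * c)) _ _ ⟩
  f (2 * c) + (f (suc (2 * c)) + rangeSum (2 * suc c) (2 * k) f)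
    ≡⟨ cong (λ a → f (2 * c) + (f (suc (2 * c)) + rangeSum a (2 * k) f)) (*-suc 2 c) ⟩
  rangeSum (2 * c) (2 + 2 * k) f
    ≡⟨ cong (λ l → rangeSum (2 * c) l f) (*-suc 2 k) ⟨
  rangeSum (2 * c) (2 * suc k) f ∎
  where open ≡-Reasoning

rangeSum-quads : ∀ a c k f →
  rangeSum c k (λ i → f (a + 4 * i + 0) + (f (a + 4 * i + 1) + (f (a + 4 * i + 2) + f (a + 4 * i + 3))))
  ≡ rangeSum (a + 4 * c) (4 * k) f
rangeSum-quads a c zero    f = refl
rangeSum-quads a c (suc k) f = begin
  quad (a + 4 * c) + rangeSum (suc c) k _
    ≡⟨ cong₂ _+_ (quad≡ (a + 4 * c)) (rangeSum-quads a (suc c) k f) ⟩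
  rangeSum (a + 4 * c) 4 f + rangeSum (a + 4 * suc c) (4 * k) f
    ≡⟨ cong (λ b → rangeSum (a + 4 * c) 4 f + rangeSum b (4 * k) f) (next a c) ⟨
  rangeSum (a + 4 * c) 4 f + rangeSum (a + 4 * c + 4) (4 * k) f
    ≡⟨ rangeSum-++ (a + 4 * c) 4 (4 * k) f ⟨
  rangeSum (a + 4 * c) (4 + 4 * k) f
    ≡⟨ cong (λ l → rangeSum (a + 4 * c) l f) (*-suc 4 k) ⟨
  rangeSum (a + 4 * c) (4 * suc k) f ∎
  where
  open ≡-Reasoning
  quad : ℕ → ℕ
  quad x = f (x + 0) + (f (x + 1) + (f (x + 2) + f (x + 3)))
  quad≡ : ∀ x → quad x ≡ rangeSum x 4 f
  quad≡ x = cong₂ _+_ (cong f (+-identityʳ x)) (cong₂ _+_ (cong f (+-comm x 1))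
              (cong₂ _+_ (cong f (+-comm x 2)) (trans (cong f (+-comm x 3)) (sym (+-identityʳ _)))))
  next : ∀ a c → a + 4 * c + 4 ≡ a + 4 * suc c
  next = solve-∀

rangeSum-double : ∀ k f → rangeSum 0 k f + rangeSum k k f ≡ rangeSum 0 (2 * k) f
rangeSum-double k f = trans (sym (rangeSum-++ 0 k k f)) (cong (λ l → rangeSum 0 l f) (k+k≡2k k))
  where
  k+k≡2k : ∀ k → k + k ≡ 2 * k
  k+k≡2k = solve-∀

module TreeSums (n : ℕ) (w : ℕ → ℕ) where

  gadgetWeight : ℕ → ℕ
  gadgetWeight m = w (gad n m 0) + (w (gad n m 1) + (w (gad n m 2) + w (gad n m 3)))

  subtreeWeight : ℕ → ℕ → ℕ
  subtreeWeight c zero    = w c + gadgetWeight (c ∸ L n)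
  subtreeWeight c (suc h) = w c + (subtreeWeight (2 * c) h + subtreeWeight (2 * c + 1) h)

  private
    G : ℕ → ℕ
    G c = gadgetWeight (c ∸ L n)

  -- the subtrees rooted at k, …, 2k − 1 fill the rows [k 2ⁱ, 2k 2ⁱ) of the heap
  rows-of-subtrees : ∀ h k →
    rangeSum 0 k w + rangeSum k k (λ c → subtreeWeight c h)
    ≡ rangeSum 0 (2 ^ suc h * k) w + rangeSum (2 ^ h * k) (2 ^ h * k) G
  rows-of-subtrees zero k = begin
    rangeSum 0 k w + rangeSum k k (λ c → w c + G c)
      ≡⟨ cong (rangeSum 0 k w +_) (rangeSum-+ k k w G) ⟩
    rangeSum 0 k w + (rangeSum k k w + rangeSum k k G)
      ≡⟨ +-assoc (rangeSum 0 k w) _ _ ⟨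
    rangeSum 0 k w + rangeSum k k w + rangeSum k k G
      ≡⟨ cong₂ (λ x a → x + rangeSum a a G) (rangeSum-double k w) (sym (*-identityˡ k)) ⟩
    rangeSum 0 (2 * k) w + rangeSum (1 * k) (1 * k) G ∎
    where open ≡-Reasoning
  rows-of-subtrees (suc h) k = begin
    rangeSum 0 k w + rangeSum k k (λ c → w c + (S (2 * c) + S (2 * c + 1)))
      ≡⟨ cong (rangeSum 0 k w +_) (rangeSum-+ k k w _) ⟩
    rangeSum 0 k w + (rangeSum k k w + rangeSum k k (λ c → S (2 * c) + S (2 * c + 1)))
      ≡⟨ cong (λ x → rangeSum 0 k w + (rangeSum k k w + x)) (rangeSum-pairs k k S) ⟩
    rangeSum 0 k w + (rangeSum k k w + rangeSum (2 * k) (2 * k) S)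
      ≡⟨ +-assoc (rangeSum 0 k w) _ _ ⟨
    rangeSum 0 k w + rangeSum k k w + rangeSum (2 * k) (2 * k) S
      ≡⟨ cong (_+ rangeSum (2 * k) (2 * k) S) (rangeSum-double k w) ⟩
    rangeSum 0 (2 * k) w + rangeSum (2 * k) (2 * k) S
      ≡⟨ rows-of-subtrees h (2 * k) ⟩
    rangeSum 0 (2 ^ suc h * (2 * k)) w + rangeSum (2 ^ h * (2 * k)) (2 ^ h * (2 * k)) G
      ≡⟨ cong₂ (λ l a → rangeSum 0 l w + rangeSum a a G) (double-inside (2 ^ suc h) k) (double-inside (2 ^ h) k) ⟩
    rangeSum 0 (2 ^ suc (suc h) * k) w + rangeSum (2 ^ suc h * k) (2 ^ suc h * k) G ∎
    where
    open ≡-Reasoning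
    S : ℕ → ℕ
    S c = subtreeWeight c h
    double-inside : ∀ p k → p * (2 * k) ≡ 2 * p * k
    double-inside = solve-∀

  whole-tree : ∀ h → 2 ^ h ≡ L n → w 0 + subtreeWeight 1 h ≡ rangeSum 0 (size n) w
  whole-tree h 2^h≡K = begin
    w 0 + subtreeWeight 1 h
      ≡⟨ cong₂ _+_ (+-identityʳ (w 0)) (+-identityʳ _) ⟨
    rangeSum 0 1 w + rangeSum 1 1 (λ c → subtreeWeight c h)
      ≡⟨ rows-of-subtrees h 1 ⟩
    rangeSum 0 (2 ^ suc h * 1) w + rangeSum (2 ^ h * 1) (2 ^ h * 1) G
      ≡⟨ cong₂ (λ l a → rangeSum 0 l w + rangeSum a a G)
               (trans (*-identityʳ _) (cong (2 *_) 2^h≡K)) (trans (*-identityʳ _) 2^h≡K) ⟩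
    rangeSum 0 (2 * K) w + rangeSum K K G
      ≡⟨ cong (rangeSum 0 (2 * K) w +_) gadgets ⟩
    rangeSum 0 (2 * K) w + rangeSum (2 * K) (4 * K) w
      ≡⟨ rangeSum-++ 0 (2 * K) (4 * K) w ⟨
    rangeSum 0 (2 * K + 4 * K) w
      ≡⟨ cong (λ l → rangeSum 0 l w) (2K+4K≡6K K) ⟩
    rangeSum 0 (size n) w ∎
    where
    open ≡-Reasoning
    K : ℕ
    K = L n
    2K+4K≡6K : ∀ K → 2 * K + 4 * K ≡ 6 * K
    2K+4K≡6K = solve-∀
    gadgets : rangeSum K K G ≡ rangeSum (2 * K) (4 * K) w
    gadgets = begin
      rangeSum K K G                          ≡⟨ cong (λ a → rangeSum a K G) (+-identityʳ K) ⟨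
      rangeSum (K + 0) K G                    ≡⟨ rangeSum-shift K 0 K G ⟩
      rangeSum 0 K (λ m → G (K + m))          ≡⟨ rangeSum-cong 0 K (λ m _ → cong gadgetWeight (m+n∸m≡n K m)) ⟩
      rangeSum 0 K gadgetWeight               ≡⟨ rangeSum-quads (2 * K) 0 K w ⟩
      rangeSum (2 * K + 0) (4 * K) w          ≡⟨ cong (λ a → rangeSum a (4 * K) w) (+-identityʳ (2 * K)) ⟩
      rangeSum (2 * K) (4 * K) w              ∎

rangeSum-replace-head : ∀ {k} f g → 0 < k → f 0 ≡ 0 → (∀ i → 1 ≤ i → f i ≡ g i) →
                rangeSum 0 k f + g 0 ≡ rangeSum 0 k g
rangeSum-replace-head {suc k} f g _ f0≡0 f≗g = begin
  f 0 + rangeSum 1 k f + g 0 ≡⟨ cong (λ x → x + rangeSum 1 k f + g 0) f0≡0 ⟩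
  rangeSum 1 k f + g 0       ≡⟨ +-comm (rangeSum 1 k f) (g 0) ⟩
  g 0 + rangeSum 1 k f       ≡⟨ cong (g 0 +_) (rangeSum-cong 1 k f≗g) ⟩
  g 0 + rangeSum 1 k g       ∎
  where open ≡-Reasoning

-- The layout of Ĝ_n

data Parent : ℕ → ℕ → Set where
  root  : Parent 1 0
  left  : ∀ {q} → 1 ≤ q → Parent (2 * q) q
  right : ∀ {q} → 1 ≤ q → Parent (2 * q + 1) q

Parent-unique : ∀ {c q q'} → Parent c q → Parent c q' → q ≡ q'
Parent-unique p p' with halve p | halve p'
  where
  halve : ∀ {c q} → Parent c q → ∃[ r ] (r < 2 × c ≡ 2 * q + r)
  halve root      = 1 , s≤s (s≤s z≤n) , refl
  halve (left _)  = 0 , s≤s z≤n , sym (+-identityʳ _)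
  halve (right _) = 1 , s≤s (s≤s z≤n) , refl
... | r , r<2 , refl | r' , r'<2 , eq = proj₁ (*+-injective 2 r<2 r'<2 eq)

Parent-< : ∀ {c q K} → Parent c q → c < 2 * K → q < K
Parent-< {K = zero}  root ()
Parent-< {K = suc _} root _ = s≤s z≤n
Parent-< (left _)  c<2K = *-cancelˡ-< 2 _ _ c<2K
Parent-< (right _) c<2K = *-cancelˡ-< 2 _ _ (<-trans (m<m+n _ (s≤s z≤n)) c<2K)

EdgeBetween : ℕ → ℕ → ℕ → Set
EdgeBetween n c d = Edge n c d ⊎ Edge n d c

module Layout (n : ℕ) where

  private
    K : ℕ
    K = L n

  K>0 : 0 < K
  K>0 = m^n>0 4 (n ∸ 1)

  1<2K : 1 < 2 * K
  1<2K = +-mono-≤ K>0 (≤-trans K>0 (m≤m+n K 0))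

  gadget : ℕ → Fin 5 → ℕ
  gadget m zero    = K + m
  gadget m (suc j) = gad n m (toℕ j)

  gadget⁺ : ℕ → ℕ → Fin 6 → ℕ
  gadget⁺ q m parent  = q
  gadget⁺ q m (suc i) = gadget m i

  Parent⇒Edge : ∀ {c q} → Parent c q → c < 2 * K → Edge n q c
  Parent⇒Edge root      _    = y-root
  Parent⇒Edge (left q≥1)  c<2K = tree-l _ q≥1 c<2K
  Parent⇒Edge (right q≥1) c<2K = tree-r _ q≥1 c<2K

  data EdgeShape (c d : ℕ) : Set where
    tree-edge   : Parent d c → d < 2 * K → EdgeShape c d
    gadget-edge : ∀ {m i j} → m < K → (suc i , suc j) ∈ₗ gadget-edges →
                  c ≡ gadget m i → d ≡ gadget m j → EdgeShape c d

  edge-shape : ∀ {c d} → Edge n c d → EdgeShape c d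
  edge-shape y-root           = tree-edge root 1<2K
  edge-shape (tree-l _ q≥1 lt) = tree-edge (left q≥1) lt
  edge-shape (tree-r _ q≥1 lt) = tree-edge (right q≥1) lt
  edge-shape (leaf-a m m<K)   = gadget-edge m<K (there (here refl)) refl refl
  edge-shape (leaf-b m m<K)   = gadget-edge m<K (there (there (here refl))) refl refl
  edge-shape (a-c m m<K)      = gadget-edge m<K (there (there (there (here refl)))) refl refl
  edge-shape (a-e m m<K)      = gadget-edge m<K (there (there (there (there (here refl))))) refl refl
  edge-shape (b-c m m<K)      = gadget-edge m<K (there (there (there (there (there (here refl)))))) refl refl
  edge-shape (b-e m m<K)      = gadget-edge m<K (there (there (there (there (there (there (here refl))))))) refl refl
  edge-shape (c-e m m<K)      = gadget-edge m<K (there (there (there (there (there (there (there (here refl)))))))) refl refl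

  2K≤gad : ∀ m j → 2 * K ≤ gad n m j
  2K≤gad m j = ≤-trans (m≤m+n (2 * K) (4 * m)) (m≤m+n _ j)

  K≤gadget : ∀ m i → K ≤ gadget m i
  K≤gadget m zero    = m≤m+n K m
  K≤gadget m (suc j) = ≤-trans (m≤m+n K (K + 0)) (2K≤gad m (toℕ j))

  leaf<2K : ∀ {m} → m < K → K + m < 2 * K
  leaf<2K {m} m<K = subst (K + m <_) (cong (K +_) (sym (+-identityʳ K))) (+-monoʳ-< K m<K)

  2K≤size : 2 * K ≤ size n
  2K≤size = *-monoˡ-≤ K {2} {6} (s≤s (s≤s z≤n))

  0<size : 0 < size n
  0<size = <-≤-trans (<-trans z<s 1<2K) 2K≤size

  gad<size : ∀ {m j} → m < K → j < 4 → gad n m j < size n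
  gad<size {m} {j} m<K j<4 = begin-strict
    2 * K + 4 * m + j   ≡⟨ +-assoc (2 * K) (4 * m) j ⟩
    2 * K + (4 * m + j) <⟨ +-monoʳ-< (2 * K) (*+-mono-< 4 j<4 m<K) ⟩
    2 * K + (4 * K + 0) ≡⟨ 2K+[4K+0]≡6K K ⟩
    size n              ∎
    where
    open ≤-Reasoning
    2K+[4K+0]≡6K : ∀ K → 2 * K + (4 * K + 0) ≡ 6 * K
    2K+[4K+0]≡6K = solve-∀

  gadget<size : ∀ {m} → m < K → ∀ i → gadget m i < size n
  gadget<size m<K zero    = <-≤-trans (leaf<2K m<K) 2K≤size
  gadget<size m<K (suc j) = gad<size m<K (toℕ<n j)

  gadget-injective : ∀ {m m'} → m < K → m' < K →
                     ∀ i i' → gadget m i ≡ gadget m' i' → m ≡ m' × i ≡ i'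
  gadget-injective _ _ zero zero eq = +-cancelˡ-≡ K _ _ eq , refl
  gadget-injective {m' = m'} m<K _ zero (suc j') eq =
    ⊥-elim (<⇒≱ (leaf<2K m<K) (subst (2 * K ≤_) (sym eq) (2K≤gad m' (toℕ j'))))
  gadget-injective {m} _ m'<K (suc j) zero eq =
    ⊥-elim (<⇒≱ (leaf<2K m'<K) (subst (2 * K ≤_) eq (2K≤gad m (toℕ j))))
  gadget-injective {m} {m'} _ _ (suc j) (suc j') eq
    with *+-injective 4 {m} {m'} (toℕ<n j) (toℕ<n j')
           (+-cancelˡ-≡ (2 * K) _ _ (trans (sym (+-assoc (2 * K) (4 * m) _)) (trans eq (+-assoc (2 * K) (4 * m') _))))
  ... | m≡m' , j≡j' = m≡m' , cong suc (toℕ-injective j≡j')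

  internal-neighbours : ∀ {c q d} → 1 ≤ c → c < K → Parent c q → EdgeBetween n c d →
                        d ≡ q ⊎ d ≡ 2 * c ⊎ d ≡ 2 * c + 1
  internal-neighbours c≥1 c<K pc (inj₁ e) with edge-shape e
  ... | tree-edge root _      = ⊥-elim (<⇒≱ c≥1 z≤n)
  ... | tree-edge (left _) _  = inj₂ (inj₁ refl)
  ... | tree-edge (right _) _ = inj₂ (inj₂ refl)
  ... | gadget-edge {m} {i} _ _ refl _ = ⊥-elim (<⇒≱ c<K (K≤gadget m i))
  internal-neighbours c≥1 c<K pc (inj₂ e) with edge-shape e
  ... | tree-edge pc' _ = inj₁ (Parent-unique pc' pc)
  ... | gadget-edge {m} {j = j} _ _ _ refl = ⊥-elim (<⇒≱ c<K (K≤gadget m j))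

  module AtLeaf {q m : ℕ} (m<K : m < K) (pq : Parent (K + m) q) where

    q<K : q < K
    q<K = Parent-< pq (leaf<2K m<K)

    gadget⁺<size : ∀ x → gadget⁺ q m x < size n
    gadget⁺<size zero    = <-≤-trans q<K (≤-trans (m≤m+n K (K + 0)) 2K≤size)
    gadget⁺<size (suc i) = gadget<size m<K i

    gadget⁺-injective : ∀ x y → gadget⁺ q m x ≡ gadget⁺ q m y → x ≡ y
    gadget⁺-injective zero    zero    _  = refl
    gadget⁺-injective zero    (suc j) eq = ⊥-elim (<⇒≱ q<K (subst (K ≤_) (sym eq) (K≤gadget m j)))
    gadget⁺-injective (suc i) zero    eq = ⊥-elim (<⇒≱ q<K (subst (K ≤_) eq (K≤gadget m i)))
    gadget⁺-injective (suc i) (suc j) eq = cong suc (proj₂ (gadget-injective m<K m<K i j eq))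

    gadget⁺-edge : ∀ {x y} → (x , y) ∈ₗ gadget-edges → Edge n (gadget⁺ q m x) (gadget⁺ q m y)
    gadget⁺-edge (here refl) = Parent⇒Edge pq (leaf<2K m<K)
    gadget⁺-edge (there (here refl)) = leaf-a m m<K
    gadget⁺-edge (there (there (here refl))) = leaf-b m m<K
    gadget⁺-edge (there (there (there (here refl)))) = a-c m m<K
    gadget⁺-edge (there (there (there (there (here refl))))) = a-e m m<K
    gadget⁺-edge (there (there (there (there (there (here refl)))))) = b-c m m<K
    gadget⁺-edge (there (there (there (there (there (there (here refl))))))) = b-e m m<K
    gadget⁺-edge (there (there (there (there (there (there (there (here refl)))))))) = c-e m m<K

    gadget-neighbours : ∀ {i d} → EdgeBetween n (gadget m i) d →
                        ∃[ y ] (d ≡ gadget⁺ q m y × GadgetAdj (suc i) y)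
    gadget-neighbours {i} (inj₁ e) with edge-shape e
    ... | tree-edge pc d<2K = ⊥-elim (<⇒≱ (Parent-< pc d<2K) (K≤gadget m i))
    ... | gadget-edge {i = i'} {j} m'<K mem eq refl with gadget-injective m<K m'<K i i' eq
    ...   | refl , refl = suc j , refl , inj₁ mem
    gadget-neighbours {zero} (inj₂ e) with edge-shape e
    ... | tree-edge pc _ = zero , Parent-unique pc pq , inj₂ (here refl)
    ... | gadget-edge {i = i'} {j} m'<K mem refl eq with gadget-injective m<K m'<K zero j eq
    ...   | refl , refl = suc i' , refl , inj₂ mem
    gadget-neighbours {suc i} (inj₂ e) with edge-shape e
    ... | tree-edge _ g<2K = ⊥-elim (<⇒≱ g<2K (2K≤gad m (toℕ i)))
    ... | gadget-edge {i = i'} {j} m'<K mem refl eq with gadget-injective m<K m'<K (suc i) j eq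
    ...   | refl , refl = suc i' , refl , inj₂ mem

module Embedded (n : ℕ) {N : ℕ} (F : SimpleGraph N) (φ : Fin (size n) → Fin N)
                (embedding : GoodEmbedding n F φ) where

  open GoodEmbedding embedding
  open Layout n

  -- codes outside V(Ĝ_n) are sent to the junk vertex 0
  vertex : ℕ → Fin (size n)
  vertex c with c <? size n
  ... | yes c<s = fromℕ< c<s
  ... | no  _   = fromℕ< 0<size

  toℕ-vertex : ∀ {c} → c < size n → toℕ (vertex c) ≡ c
  toℕ-vertex {c} c<s with c <? size n
  ... | yes c<s' = toℕ-fromℕ< c<s'
  ... | no  c≮s  = ⊥-elim (c≮s c<s)

  vertex-toℕ : ∀ x → vertex (toℕ x) ≡ x
  vertex-toℕ x = toℕ-injective (toℕ-vertex (toℕ<n x))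

  φℕ : ℕ → Fin N
  φℕ c = φ (vertex c)

  φℕ-injective : ∀ {c d} → c < size n → d < size n → φℕ c ≡ φℕ d → c ≡ d
  φℕ-injective c<s d<s eq =
    trans (sym (toℕ-vertex c<s)) (trans (cong toℕ (injective _ _ eq)) (toℕ-vertex d<s))

  φℕ-adjacent : ∀ {c d} → c < size n → d < size n → EdgeBetween n c d → Adj F (φℕ c) (φℕ d)
  φℕ-adjacent {c} {d} c<s d<s e =
    proj₁ (induced (vertex c) (vertex d))
      (subst₂ (EdgeBetween n) (sym (toℕ-vertex c<s)) (sym (toℕ-vertex d<s)) e)

  φℕ-neighbour : ∀ {c w} → c < size n → 1 ≤ c → Adj F (φℕ c) w →
                 ∃[ d ] (d < size n × w ≡ φℕ d × EdgeBetween n c d)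
  φℕ-neighbour {c} {w} c<s c≥1 c~w with any? (λ z → φ z Fin.≟ w)
  ... | yes (z , φz≡w) =
    toℕ z , toℕ<n z , trans (sym φz≡w) (cong φ (sym (vertex-toℕ z))) ,
    subst (λ c → EdgeBetween n c (toℕ z)) (toℕ-vertex c<s)
      (proj₂ (induced (vertex c) z) (subst (Adj F (φℕ c)) (sym φz≡w) c~w))
  ... | no w∉φ = ⊥-elim (isolated (vertex c) w in-G (λ z φz≡w → w∉φ (z , φz≡w)) c~w)
    where
    in-G : InG {n} (vertex c)
    in-G eq = <⇒≢ c≥1 (sym (trans (sym (toℕ-vertex c<s)) eq))

  φℕ-toℕ : ∀ {x c} → toℕ x ≡ c → φℕ c ≡ φ x
  φℕ-toℕ {x} refl = cong φ (vertex-toℕ x)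

  G-avoids-y : ∀ {z} → InG {n} z → φ z ≢ φℕ 0
  G-avoids-y {z} z∈G φz≡φy = z∈G (trans (cong toℕ (injective z (vertex 0) φz≡φy)) (toℕ-vertex 0<size))

  gadget-embedding : ∀ {q m} → m < L n → Parent (L n + m) q →
                     GadgetEmbedding F (λ x → φℕ (gadget⁺ q m x))
  gadget-embedding {q} {m} m<K pq = record
    { injective = λ x y eq → gadget⁺-injective x y (φℕ-injective (gadget⁺<size x) (gadget⁺<size y) eq)
    ; sound     = sound
    ; closed    = closed
    }
    where
    open AtLeaf m<K pq
    sound : ∀ {x y} → GadgetAdj x y → Adj F (φℕ (gadget⁺ q m x)) (φℕ (gadget⁺ q m y))
    sound {x} {y} (inj₁ xy) = φℕ-adjacent (gadget⁺<size x) (gadget⁺<size y) (inj₁ (gadget⁺-edge xy))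
    sound {x} {y} (inj₂ yx) = φℕ-adjacent (gadget⁺<size x) (gadget⁺<size y) (inj₂ (gadget⁺-edge yx))
    closed : ∀ {x w} → x ≢ parent → Adj F (φℕ (gadget⁺ q m x)) w →
             ∃[ y ] (w ≡ φℕ (gadget⁺ q m y) × GadgetAdj x y)
    closed {zero}  x≢p _ = ⊥-elim (x≢p refl)
    closed {suc i} _ x~w with φℕ-neighbour (gadget<size m<K i) (≤-trans K>0 (K≤gadget m i)) x~w
    ... | d , _ , refl , e with gadget-neighbours e
    ...   | y , refl , x~y = y , refl , x~y

-- The induction over the tree

double : ℕ → ℕ
double zero    = zero
double (suc e) = suc (suc (double e))

2^double≡4^ : ∀ e → 2 ^ double e ≡ 4 ^ e
2^double≡4^ zero    = refl
2^double≡4^ (suc e) = trans (sym (*-assoc 2 2 (2 ^ double e))) (cong (4 *_) (2^double≡4^ e))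

record InRow (d c : ℕ) : Set where
  constructor _,_
  field
    lower : 2 ^ d ≤ c
    upper : c < 2 ^ suc d

InRow-positive : ∀ {d c} → InRow d c → 1 ≤ c
InRow-positive {d} (2^d≤c , _) = ≤-trans (m^n>0 2 d) 2^d≤c

InRow-< : ∀ {d d' c} → InRow d c → suc d ≤ d' → c < 2 ^ d'
InRow-< (_ , c<2^sd) sd≤d' = <-≤-trans c<2^sd (^-monoʳ-≤ 2 sd≤d')

InRow-children : ∀ {d c} → InRow d c → InRow (suc d) (2 * c) × InRow (suc d) (2 * c + 1)
InRow-children {d} {c} (2^d≤c , c<2^sd) =
  (lower , <-trans (m<m+n (2 * c) z<s) upper) , (≤-trans lower (m≤m+n (2 * c) 1) , upper)
  where
  lower : 2 ^ suc d ≤ 2 * c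
  lower = *-monoʳ-≤ 2 2^d≤c
  upper : 2 * c + 1 < 2 ^ suc (suc d)
  upper = subst (_≤ 2 ^ suc (suc d)) (2[1+c]≡2c+1+1 c) (*-monoʳ-≤ 2 c<2^sd)
    where
    2[1+c]≡2c+1+1 : ∀ c → 2 * suc c ≡ suc (2 * c + 1)
    2[1+c]≡2c+1+1 = solve-∀

count-from-tabulate : ∀ k a (f : Fin k → Bool) (g : ℕ → ℕ) →
                      (∀ x → χ (f x) ≡ g (a + toℕ x)) → ∣ tabulate f ∣ ≡ rangeSum a k g
count-from-tabulate zero    a f g f≗g = refl
count-from-tabulate (suc k) a f g f≗g =
  trans (∣x∷p∣ (f zero) (tabulate (f ∘ suc)))
    (cong₂ _+_ (trans (f≗g zero) (cong g (+-identityʳ a)))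
               (count-from-tabulate k (suc a) (f ∘ suc) g
                  (λ x → trans (f≗g (suc x)) (cong g (+-suc a (toℕ x))))))
  where
  ∣x∷p∣ : ∀ {k} x (p : Subset k) → ∣ x ∷ p ∣ ≡ χ x + ∣ p ∣
  ∣x∷p∣ true  p = refl
  ∣x∷p∣ false p = refl

module Weights (n' : ℕ) {N : ℕ} (F : SimpleGraph N) (φ : Fin (size (suc n')) → Fin N)
               (embedding : GoodEmbedding (suc n') F φ) (P : Subset N) where

  open Embedded (suc n') F φ embedding
  open Layout (suc n')

  black : ℕ → ℕ
  black c = χ (lookup P (φℕ c))

  open TreeSums (suc n') black public

  K≡2^ : 2 ^ double n' ≡ L (suc n')
  K≡2^ = 2^double≡4^ n'

  countGP≡subtreeWeight : countGP (suc n') φ P ≡ subtreeWeight 1 (double n')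
  countGP≡subtreeWeight = +-cancelʳ-≡ (black 0) _ _ (begin
    countGP (suc n') φ P + black 0
      ≡⟨ cong (_+ black 0) (count-from-tabulate _ 0 _ inG-black inG-black≗) ⟩
    rangeSum 0 (size (suc n')) inG-black + black 0
      ≡⟨ rangeSum-replace-head inG-black black 0<size refl (λ { (suc i) _ → refl }) ⟩
    rangeSum 0 (size (suc n')) black
      ≡⟨ whole-tree (double n') K≡2^ ⟨
    black 0 + subtreeWeight 1 (double n')
      ≡⟨ +-comm (black 0) _ ⟩
    subtreeWeight 1 (double n') + black 0 ∎)
    where
    open ≡-Reasoning
    inG-black : ℕ → ℕ
    inG-black c = χ ((0 <ᵇ c) ∧ lookup P (φℕ c))
    isG≡0<ᵇ : ∀ x → isG {suc n'} x ≡ (0 <ᵇ toℕ x)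
    isG≡0<ᵇ x with toℕ x
    ... | zero  = refl
    ... | suc _ = refl
    inG-black≗ : ∀ x → χ (isG {suc n'} x ∧ lookup P (φ x)) ≡ inG-black (toℕ x)
    inG-black≗ x = cong₂ (λ b v → χ (b ∧ lookup P (φ v))) (isG≡0<ᵇ x) (sym (vertex-toℕ x))

module Thresholds (n' : ℕ) {N : ℕ} (F : SimpleGraph N) (φ : Fin (size (suc n')) → Fin N)
                  (embedding : GoodEmbedding (suc n') F φ)
                  {P : Subset N} {fs : List (Fin N × Fin N)} {B' : Subset N}
                  (seq : ForceSeq F P fs B') (all-black : ∀ x → x ∈ B') where

  open Embedded (suc n') F φ embedding
  open Layout (suc n')
  open ZeroForcing F
  open Weights n' F φ embedding P

  private
    K : ℕ
    K = L (suc n')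

  record Threshold (j c q : ℕ) : Set where
    constructor _,_
    field
      bound : t (suc j) ≤ subtreeWeight c (double j)
      tight : subtreeWeight c (double j) ≡ t (suc j) →
              φℕ c ∉ P × (∀ v → (v , φℕ c) ∈ₗ fs → v ≡ φℕ q)

  -- Claim j is about the vertices of height 2j, on row d with d + 2j = 2n' (the leaves form row 2n')
  Claim : ℕ → Set
  Claim j = ∀ {d c q} → d + double j ≡ double n' → InRow d c → Parent c q → Threshold j c q

  private
    InRow⇒<2K : ∀ {d c} j → InRow d c → d + j ≡ double n' → c < 2 * K
    InRow⇒<2K {d} j row eq =
      subst (λ x → _ < 2 * x) K≡2^ (InRow-< row (s≤s (subst (d ≤_) eq (m≤m+n d j))))

    InRow⇒<K : ∀ {d c} j → InRow d c → suc (suc d) + j ≡ double n' → c < K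
    InRow⇒<K {d} j row eq =
      subst (_ <_) K≡2^ (InRow-< row (subst (suc d ≤_) eq (≤-trans (n≤1+n (suc d)) (m≤m+n _ j))))

    InRow⇒<size : ∀ {d c} j → InRow d c → d + j ≡ double n' → c < size (suc n')
    InRow⇒<size j row eq = <-≤-trans (InRow⇒<2K j row eq) 2K≤size

  gadget-threshold : ∀ {m q} → m < K → Parent (K + m) q → Threshold 0 (K + m) q
  gadget-threshold {m} m<K pq =
    subst (2 ≤_) (sym weight≡) (≤-trans two-black-in-K4 (m≤n+m _ (black (K + m)))) ,
    λ tight → gadget-tight (trans (sym weight≡) tight)
    where
    open GadgetForcing (gadget-embedding m<K pq) seq all-black
    weight≡ : subtreeWeight (K + m) 0 ≡ black (K + m) + gadgetWeight m
    weight≡ = cong (λ m' → black (K + m) + gadgetWeight m') (m+n∸m≡n K m)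

  claim-leaves : Claim 0
  claim-leaves {d} {c} {q} eq row pc = subst (λ c → Threshold 0 c q) K+m≡c
    (gadget-threshold m<K (subst (λ c → Parent c q) (sym K+m≡c) pc))
    where
    K≤c : K ≤ c
    K≤c = subst (_≤ c) (trans (cong (2 ^_) (trans (sym (+-identityʳ d)) eq)) K≡2^) (InRow.lower row)
    K+m≡c : K + (c ∸ K) ≡ c
    K+m≡c = m+[n∸m]≡n K≤c
    m<K : c ∸ K < K
    m<K = +-cancelˡ-< K _ K (subst₂ _<_ (sym K+m≡c) (cong (K +_) (+-identityʳ K)) (InRow⇒<2K 0 row eq))

  tight-forced-by-parent : ∀ {j g c'} → Threshold j g c' →
                           subtreeWeight g (double j) ≡ t (suc j) → (φℕ c' , φℕ g) ∈ₗ fs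
  tight-forced-by-parent (_ , tight) eq with tight eq
  ... | g∉P , only-parent with turned-black-was-forced seq (all-black _) g∉P
  ...   | v , v→g = subst (λ v → (v , _) ∈ₗ fs) (only-parent v v→g) v→g

  pairWeight : ℕ → ℕ → ℕ
  pairWeight j c' = subtreeWeight (2 * c') (double j) + subtreeWeight (2 * c' + 1) (double j)

  record ChildBound (j c' : ℕ) : Set where
    field
      at-least : suc (t (suc j) + t (suc j)) ≤ pairWeight j c'
      busy     : pairWeight j c' ≡ suc (t (suc j) + t (suc j)) →
                 ∀ {c} → c < c' → c < size (suc n') → ¬ (φℕ c' , φℕ c) ∈ₗ fs

  -- Two tight children of c' would both have to be forced by c'; a single tight child
  -- keeps c' from forcing anything else.
  child-bound : ∀ {j d c'} → Claim j → suc (suc d) + double j ≡ double n' → InRow (suc d) c' →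
                ChildBound j c'
  child-bound {j} {d} {c'} ih eq row =
    record { at-least = pair-bound (bound th₁) (bound th₂) not-twins ; busy = busy }
    where
    open Threshold using (bound)
    c'≥1 : 1 ≤ c'
    c'≥1 = InRow-positive row
    rows : InRow (suc (suc d)) (2 * c') × InRow (suc (suc d)) (2 * c' + 1)
    rows = InRow-children row
    th₁ : Threshold j (2 * c') c'
    th₁ = ih eq (proj₁ rows) (left c'≥1)
    th₂ : Threshold j (2 * c' + 1) c'
    th₂ = ih eq (proj₂ rows) (right c'≥1)
    g₁<s : 2 * c' < size (suc n')
    g₁<s = InRow⇒<size (double j) (proj₁ rows) eq
    g₂<s : 2 * c' + 1 < size (suc n')
    g₂<s = InRow⇒<size (double j) (proj₂ rows) eq
    c'<2c' : c' < 2 * c'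
    c'<2c' = m<m+n c' (≤-trans c'≥1 (m≤m+n c' 0))
    not-twins : ¬ (subtreeWeight (2 * c') (double j) ≡ t (suc j) ×
                   subtreeWeight (2 * c' + 1) (double j) ≡ t (suc j))
    not-twins (tight₁ , tight₂) = <⇒≢ (m<m+n (2 * c') z<s) (φℕ-injective g₁<s g₂<s
      (forces-at-most-once seq (tight-forced-by-parent th₁ tight₁) (tight-forced-by-parent th₂ tight₂)))
    busy : pairWeight j c' ≡ suc (t (suc j) + t (suc j)) →
           ∀ {c} → c < c' → c < size (suc n') → ¬ (φℕ c' , φℕ c) ∈ₗ fs
    busy tight {c} c<c' c<s c'→c with pair-tight (bound th₁) (bound th₂) tight
    ... | inj₁ tight₁ = <⇒≢ (<-trans c<c' c'<2c') (φℕ-injective c<s g₁<s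
                          (forces-at-most-once seq c'→c (tight-forced-by-parent th₁ tight₁)))
    ... | inj₂ tight₂ = <⇒≢ (<-trans c<c' (≤-trans c'<2c' (m≤m+n (2 * c') 1))) (φℕ-injective c<s g₂<s
                          (forces-at-most-once seq c'→c (tight-forced-by-parent th₂ tight₂)))

  forcer-is-neighbour : ∀ {c q v} → 1 ≤ c → c < K → c < size (suc n') → Parent c q →
                        (v , φℕ c) ∈ₗ fs → v ≡ φℕ q ⊎ v ≡ φℕ (2 * c) ⊎ v ≡ φℕ (2 * c + 1)
  forcer-is-neighbour c≥1 c<K c<s pc v→c with φℕ-neighbour c<s c≥1 (symm F (forced-adjacent seq v→c))
  ... | _ , _ , refl , e with internal-neighbours c≥1 c<K pc e
  ...   | inj₁ refl        = inj₁ refl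
  ...   | inj₂ (inj₁ refl) = inj₂ (inj₁ refl)
  ...   | inj₂ (inj₂ refl) = inj₂ (inj₂ refl)

  claim-step : ∀ {j} → Claim j → Claim (suc j)
  claim-step {j} ih {d} {c} {q} eq row pc =
    four-bound {t (suc j)} {black c} {black (2 * c)} {black (2 * c + 1)} bound₁ bound₂ , tight
    where
    below : suc (suc d) + double j ≡ double n'
    below = trans (sym (trans (+-suc d (suc (double j))) (cong suc (+-suc d (double j))))) eq
    open ChildBound (child-bound ih below (proj₁ (InRow-children row))) renaming (at-least to bound₁; busy to busy₁)
    open ChildBound (child-bound ih below (proj₂ (InRow-children row))) renaming (at-least to bound₂; busy to busy₂)
    c≥1 : 1 ≤ c
    c≥1 = InRow-positive row
    c<2c : c < 2 * c
    c<2c = m<m+n c (≤-trans c≥1 (m≤m+n c 0))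
    c<s : c < size (suc n')
    c<s = InRow⇒<size _ row eq
    tight : subtreeWeight c (double (suc j)) ≡ t (suc (suc j)) →
            φℕ c ∉ P × (∀ v → (v , φℕ c) ∈ₗ fs → v ≡ φℕ q)
    tight eqW = lookup≡false⇒∉ P (φℕ c) (χ≡0⇒false (proj₁ split)) , forced-by-q
      where
      split : black c ≡ 0 × pairWeight j (2 * c) ≡ suc (t (suc j) + t (suc j)) ×
              pairWeight j (2 * c + 1) ≡ suc (t (suc j) + t (suc j))
      split = four-tight {t (suc j)} {black c} {black (2 * c)} {black (2 * c + 1)} bound₁ bound₂ eqW
      forced-by-q : ∀ v → (v , φℕ c) ∈ₗ fs → v ≡ φℕ q
      forced-by-q v v→c with forcer-is-neighbour c≥1 (InRow⇒<K (double j) row below) c<s pc v→c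
      ... | inj₁ v≡φq        = v≡φq
      ... | inj₂ (inj₁ refl) = ⊥-elim (busy₁ (proj₁ (proj₂ split)) c<2c c<s v→c)
      ... | inj₂ (inj₂ refl) =
        ⊥-elim (busy₂ (proj₂ (proj₂ split)) (<-≤-trans c<2c (m≤m+n (2 * c) 1)) c<s v→c)

  claim : ∀ j → Claim j
  claim zero    = claim-leaves
  claim (suc j) = claim-step (claim j)

  root-threshold : Threshold n' 1 0
  root-threshold = claim n' refl (s≤s z≤n , s≤s (s≤s z≤n)) root

module Root (n' : ℕ) {N : ℕ} (F : SimpleGraph N) (φ : Fin (size (suc n')) → Fin N)
            (embedding : GoodEmbedding (suc n') F φ) {P : Subset N} (zfs : ZeroForcingSet F P) where

  open Embedded (suc n') F φ embedding
  open Weights n' F φ embedding P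
  open ZeroForcing F

  private
    module Complete {fs B'} (seq : ForceSeq F P fs B') (all-black : ∀ x → x ∈ B') =
      Thresholds n' F φ embedding seq all-black

    weight≡ : countGP (suc n') φ P ≡ t (suc n') → subtreeWeight 1 (double n') ≡ t (suc n')
    weight≡ tight = trans (sym countGP≡subtreeWeight) tight

    root-facts : ∀ {fs B'} → ForceSeq F P fs B' →
                 t (suc n') ≤ countGP (suc n') φ P ×
                 (countGP (suc n') φ P ≡ t (suc n') →
                  φℕ 1 ∉ P × (∀ v → (v , φℕ 1) ∈ₗ fs → v ≡ φℕ 0))
    root-facts seq with extend-to-complete zfs seq
    ... | _ , _ , seq₂ , all-black₂ , fs⊆fs₂ =
      subst (t (suc n') ≤_) (sym countGP≡subtreeWeight) (Threshold.bound root-threshold) ,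
      λ tight → let r∉P , only-y = Threshold.tight root-threshold (weight≡ tight)
                in r∉P , λ v v→r → only-y v (fs⊆fs₂ v→r)
      where open Complete seq₂ all-black₂

  root-bound : t (suc n') ≤ countGP (suc n') φ P
  root-bound = proj₁ (root-facts done)

  root-white : countGP (suc n') φ P ≡ t (suc n') → φℕ 1 ∉ P
  root-white tight = proj₁ (proj₂ (root-facts done) tight)

  root-forced-by-y : countGP (suc n') φ P ≡ t (suc n') → ∀ {fs B' v} → ForceSeq F P fs B' →
                     (v , φℕ 1) ∈ₗ fs → v ≡ φℕ 0
  root-forced-by-y tight seq v→r = proj₂ (proj₂ (root-facts seq) tight) _ v→r

lemma1 : (n : ℕ) → 1 ≤ n →
    {N : ℕ} (F : SimpleGraph N) (φ : Fin (size n) → Fin N) →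
    GoodEmbedding n F φ →
    (P : Subset N) → ZeroForcingSet F P →
    (countGP n φ P ≥ t n)
    × (countGP n φ P ≡ t n →
        ((r : Fin (size n)) → toℕ r ≡ 1 → φ r ∉ P)
        × (∀ fs B' → ForceSeq F P fs B' →
           (r : Fin (size n)) → toℕ r ≡ 1 →
           (v : Fin N) → (v , φ r) ∈ₗ fs →
           (z : Fin (size n)) → InG {n} z → φ z ≢ v))
lemma1 (suc n') _ F φ embedding P zfs =
  root-bound ,
  λ tight → (λ r r≡1 → subst (_∉ P) (φℕ-toℕ r≡1) (root-white tight)) ,
            (λ fs B' seq r r≡1 v v→r z z∈G φz≡v →
               G-avoids-y z∈G (trans φz≡v (root-forced-by-y tight seq
                 (subst (λ w → (v , w) ∈ₗ fs) (sym (φℕ-toℕ r≡1)) v→r))))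
  where
  open Root n' F φ embedding zfs
  open Embedded (suc n') F φ embedding
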